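{- Let $P$ be a finite poset with a layer structure $(\epsilon,\lambda)$ satisfying property (M) with associated maps $m^\pm$. Then the double $\mathcal{D}_P$, with its canonical layer structure, also satisfies property (M), and, identifying $\mathcal{D}_P$ with $P\times\{ -1,1\}$, its associated maps $\widehat m^\pm$ are \[ \widehat m^+(x,\epsilon)=\begin{cases}(x,1) & \epsilon=1,\\ (\delta(m^+(x)),1) & \epsilon=-1,\end{cases}\qquad \widehat m^-(x,\epsilon)=\begin{cases}(x,-1) & \epsilon=-1,\\ (\lambda(m^-(x)),-1) & \epsilon=1.\end{cases} \]
   Context: A layer structure on a poset $P$ is a pair $(\epsilon,\lambda)$ where $\epsilon:P\to\{ -1,1\}$ is increasing, $P^\pm:=\epsilon^{ -1}(\pm1)$, and $\lambda:P^-\to P^+$ is a poset isomorphism (for the induced orders) with $x<\lambda(x)$ for all $x\in P^-$; $\delta=\lambda^{ -1}:P^+\to P^-$. The layer structure satisfies property (M) if for every $x\in P$ the sets $\{p\in P^+:p\ge x\}$ and $\{p\in P^-:p\le x\}$ are nonempty and have a minimum $m^+(x)$ and a maximum $m^-(x)$ respectively; $m^\pm:P\to P^\pm$ are the associated maps. The double $\mathcal{D}_P$ is the set $P\times\{ -1,1\}$ with the order: $(x_0,\epsilon_0)\preceq(x_1,\epsilon_1)$ iff either $\epsilon_0=\epsilon_1$ and $x_0\le x_1$, or $\epsilon_0=-1,\epsilon_1=1$ and there is $z\in P^+$ with $x_0\le z$ and $\delta(z)\le x_1$. Its canonical layer structure has sign map the projection $(x,\epsilon)\mapsto\epsilon$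 and lifting map $(x,-1)\mapsto(x,1)$. -}

module Defs where

open import Data.Nat using (ℕ)
open import Data.Fin using (Fin)
open import Data.Sign.Base using (Sign; +; -)
open import Data.Product using (Σ; _×_; _,_; proj₁; proj₂)
open import Relation.Binary.PropositionalEquality using (_≡_)
open import Relation.Binary.Structures using (IsPartialOrder)
open import Function.Bundles using (_↔_)
open import Relation.Nullary using (¬_)

data _≤ₛ_ : Sign → Sign → Set where
  -≤s : ∀ {s} → - ≤ₛ s
  +≤+ : + ≤ₛ +

record FinitePoset : Set₁ where
  field
    Carrier        : Set
    _≤_            : Carrier → Carrier → Set
    isPartialOrder : IsPartialOrder _≡_ _≤_
    size           : ℕ
    finite         : Carrier ↔ Fin size

  _<_ : Carrier → Carrier → Set
  x < y = (x ≤ y) × ¬ (x ≡ y)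

record LayerStructure (P : FinitePoset) : Set where
  open FinitePoset P
  field
    ε      : Carrier → Sign
    ε-mono : ∀ {x y} → x ≤ y → ε x ≤ₛ ε y

  Pos : Set
  Pos = Σ Carrier (λ x → ε x ≡ +)

  Neg : Set
  Neg = Σ Carrier (λ x → ε x ≡ -)

  field
    lift      : Neg → Pos          -- λ
    δ         : Pos → Neg
    lift-δ    : ∀ p → lift (δ p) ≡ p
    δ-lift    : ∀ q → δ (lift q) ≡ q
    lift-mono : ∀ q r → proj₁ q ≤ proj₁ r → proj₁ (lift q) ≤ proj₁ (lift r)
    δ-mono    : ∀ p p' → proj₁ p ≤ proj₁ p' → proj₁ (δ p) ≤ proj₁ (δ p')
    lift-above : ∀ q → proj₁ q < proj₁ (lift q)

module _ {A : Set} (_≼_ : A → A → Set) (s : A → Sign) where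

  IsMinAbove : A → A → Set
  IsMinAbove x m = (s m ≡ +) × (x ≼ m) × (∀ p → s p ≡ + → x ≼ p → m ≼ p)

  IsMaxBelow : A → A → Set
  IsMaxBelow x m = (s m ≡ -) × (m ≼ x) × (∀ p → s p ≡ - → p ≼ x → p ≼ m)

  record PropertyM : Set where
    field
      m⁺     : A → A
      m⁺-min : ∀ x → IsMinAbove x (m⁺ x)
      m⁻     : A → A
      m⁻-max : ∀ x → IsMaxBelow x (m⁻ x)

module _ {P : FinitePoset} (L : LayerStructure P) where
  open FinitePoset P
  open LayerStructure L

  m⁺P : PropertyM _≤_ ε → Carrier → Pos
  m⁺P M x = PropertyM.m⁺ M x , proj₁ (PropertyM.m⁺-min M x)

  m⁻P : PropertyM _≤_ ε → Carrier → Neg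
  m⁻P M x = PropertyM.m⁻ M x , proj₁ (PropertyM.m⁻-max M x)

  -- The order of the double D_P on P × {-1,1}.
  data _⊑_ : Carrier × Sign → Carrier × Sign → Set where
    same  : ∀ {x y e} → x ≤ y → (x , e) ⊑ (y , e)
    cross : ∀ {x y} (z : Pos) → x ≤ proj₁ z → proj₁ (δ z) ≤ y → (x , -) ⊑ (y , +)

module Submission where

-- In the
-- double D_P the relations inside one layer are those of P, so the two
-- "trivial" values m̂⁺(x,+) = (x,+) and m̂⁻(x,-) = (x,-) are immediate.  The
-- content lies in the relations between the layers, which the maps m± of P
-- describe completely:
--
--   (x,-) ⊑ (y,+)  iff  δ(m⁺ x) ≤ y     (cross-above-δm⁺ and its converse)
--   (y,-) ⊑ (x,+)  iff  y ≤ λ(m⁻ x)     (cross-below-λm⁻ and its converse)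
--
-- The first holds because m⁺ x is the least admissible z in the definition
-- of ⊑ and δ is monotone; the second because δ z ≤ x forces δ z ≤ m⁻ x, and
-- λ is monotone with λ ∘ δ = id.  Read with y (resp. x) as the unknown, these
-- equivalences say precisely that (δ(m⁺ x),+) is the least element of the
-- upper layer above (x,-) and (λ(m⁻ x),-) the greatest element of the lower
-- layer below (x,+).

open import Defs
open import Data.Sign.Base using (Sign; +; -)
open import Data.Product using (Σ; _×_; _,_; proj₁; proj₂)
open import Relation.Binary.PropositionalEquality using (_≡_; refl; sym; subst)
open import Relation.Binary.Structures using (IsPartialOrder)

module LayerFacts {P : FinitePoset} (L : LayerStructure P) where
  open FinitePoset P
  open LayerStructure L

  ≤-lift-of-δ≤ : ∀ p q → proj₁ (δ p) ≤ proj₁ q → proj₁ p ≤ proj₁ (lift q)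
  ≤-lift-of-δ≤ p q δp≤q =
    subst (λ r → proj₁ r ≤ proj₁ (lift q)) (lift-δ p) (lift-mono (δ p) q δp≤q)

  δ-lift-≤ : ∀ q {y} → proj₁ q ≤ y → proj₁ (δ (lift q)) ≤ y
  δ-lift-≤ q {y} q≤y = subst (λ r → proj₁ r ≤ y) (sym (δ-lift q)) q≤y

module DoubleExtrema {P : FinitePoset} (L : LayerStructure P)
                     (M : PropertyM (FinitePoset._≤_ P) (LayerStructure.ε L)) where
  open FinitePoset P
  open LayerStructure L
  open PropertyM M
  open LayerFacts L
  open IsPartialOrder isPartialOrder using (reflexive; trans)

  ≤-refl : ∀ {x} → x ≤ x
  ≤-refl = reflexive refl

  μ⁺ : Carrier → Pos
  μ⁺ = m⁺P L M

  μ⁻ : Carrier → Neg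
  μ⁻ = m⁻P L M

  ⊑-refl : ∀ {a} → _⊑_ L a a
  ⊑-refl = same ≤-refl

  cross-above-δm⁺ : ∀ {x y} → _⊑_ L (x , -) (y , +) → proj₁ (δ (μ⁺ x)) ≤ y
  cross-above-δm⁺ {x} (cross z x≤z δz≤y) =
    trans (δ-mono (μ⁺ x) z (proj₂ (proj₂ (m⁺-min x)) (proj₁ z) (proj₂ z) x≤z)) δz≤y

  cross-above-δm⁺⁻¹ : ∀ {x y} → proj₁ (δ (μ⁺ x)) ≤ y → _⊑_ L (x , -) (y , +)
  cross-above-δm⁺⁻¹ {x} = cross (μ⁺ x) (proj₁ (proj₂ (m⁺-min x)))

  cross-below-λm⁻ : ∀ {x y} → _⊑_ L (y , -) (x , +) → y ≤ proj₁ (lift (μ⁻ x))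
  cross-below-λm⁻ {x} (cross z y≤z δz≤x) =
    trans y≤z (≤-lift-of-δ≤ z (μ⁻ x)
      (proj₂ (proj₂ (m⁻-max x)) (proj₁ (δ z)) (proj₂ (δ z)) δz≤x))

  cross-below-λm⁻⁻¹ : ∀ {x y} → y ≤ proj₁ (lift (μ⁻ x)) → _⊑_ L (y , -) (x , +)
  cross-below-λm⁻⁻¹ {x} y≤λq =
    cross (lift (μ⁻ x)) y≤λq (δ-lift-≤ (μ⁻ x) (proj₁ (proj₂ (m⁻-max x))))

  m̂⁺ : Carrier × Sign → Carrier × Sign
  m̂⁺ (x , +) = x , +
  m̂⁺ (x , -) = proj₁ (δ (μ⁺ x)) , +

  m̂⁻ : Carrier × Sign → Carrier × Sign
  m̂⁻ (x , -) = x , -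
  m̂⁻ (x , +) = proj₁ (lift (μ⁻ x)) , -

  m̂⁺-min : ∀ a → IsMinAbove (_⊑_ L) proj₂ a (m̂⁺ a)
  m̂⁺-min (x , +) = refl , ⊑-refl , λ _ _ a⊑p → a⊑p
  m̂⁺-min (x , -) = refl , cross-above-δm⁺⁻¹ ≤-refl , least
    where
    least : ∀ p → proj₂ p ≡ + → _⊑_ L (x , -) p → _⊑_ L (m̂⁺ (x , -)) p
    least (y , +) _ x⊑y = same (cross-above-δm⁺ x⊑y)

  m̂⁻-max : ∀ a → IsMaxBelow (_⊑_ L) proj₂ a (m̂⁻ a)
  m̂⁻-max (x , -) = refl , ⊑-refl , λ _ _ p⊑a → p⊑a
  m̂⁻-max (x , +) = refl , cross-below-λm⁻⁻¹ ≤-refl , greatest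
    where
    greatest : ∀ p → proj₂ p ≡ - → _⊑_ L p (x , +) → _⊑_ L p (m̂⁻ (x , +))
    greatest (y , -) _ y⊑x = same (cross-below-λm⁻ y⊑x)

  propertyM : PropertyM (_⊑_ L) proj₂
  propertyM = record { m⁺ = m̂⁺ ; m⁺-min = m̂⁺-min ; m⁻ = m̂⁻ ; m⁻-max = m̂⁻-max }

lemma2p5 : (P : FinitePoset) (L : LayerStructure P)
    → (M : PropertyM (FinitePoset._≤_ P) (LayerStructure.ε L))
    → Σ (PropertyM (_⊑_ L) proj₂) (λ MD →
        (∀ x → PropertyM.m⁺ MD (x , +) ≡ (x , +))
        × (∀ x → PropertyM.m⁺ MD (x , -) ≡ (proj₁ (LayerStructure.δ L (m⁺P L M x)) , +))
        × (∀ x → PropertyM.m⁻ MD (x , -) ≡ (x , -))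
        × (∀ x → PropertyM.m⁻ MD (x , +) ≡ (proj₁ (LayerStructure.lift L (m⁻P L M x)) , -)))
lemma2p5 P L M =
  DoubleExtrema.propertyM L M , (λ _ → refl) , (λ _ → refl) , (λ _ → refl) , (λ _ → refl)
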